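{- Let $\Lambda=(\mathcal{L},\mathfrak{M},\models)$ be a satisfaction system. Then: (1) $\Lambda$ is eviction-compatible if and only if for every $\mathbb{M}\subseteq\mathfrak{M}$ at least one of the following holds: (i) $\mathbb{M}\in\mathrm{FR}(\Lambda)$; (ii) $\mathbb{M}$ has an immediate predecessor in the poset $(\mathrm{FR}(\Lambda)\cup\{\mathbb{M}\},\subsetneq)$; (iii) there is no $\mathbb{M}'\in\mathrm{FR}(\Lambda)$ with $\mathbb{M}\subseteq\mathbb{M}'$. (2) $\Lambda$ is reception-compatible if and only if for every $\mathbb{M}\subseteq\mathfrak{M}$ at least one of the following holds: (i) $\mathbb{M}\in\mathrm{FR}(\Lambda)$; (ii) $\mathbb{M}$ has an immediate successor in the poset $(\mathrm{FR}(\Lambda)\cup\{\mathbb{M}\},\subsetneq)$; (iii) there is no $\mathbb{M}'\in\mathrm{FR}(\Lambda)$ with $\mathbb{M}'\subseteq\mathbb{M}$.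
   Context: A satisfaction system is a triple $\Lambda=(\mathcal{L},\mathfrak{M},\models)$ where $\mathcal{L}$ is a set of formulae, $\mathfrak{M}$ a set of models, and $\models$ a relation between models and sets of formulae $B\subseteq\mathcal{L}$. $\mathrm{Mod}(B)=\{m\in\mathfrak{M}\mid m\models B\}$. $\mathrm{FR}(\Lambda)=\{X\subseteq\mathfrak{M}\mid X=\mathrm{Mod}(B)$ for some finite $B\subseteq\mathcal{L}\}$. For $\mathbb{M}\subseteq\mathfrak{M}$: $\mathrm{FRsubs}(\mathbb{M},\Lambda)=\{X\in\mathrm{FR}(\Lambda)\mid X\subseteq\mathbb{M}$ and no $Y\in\mathrm{FR}(\Lambda)$ has $X\subsetneq Y\subseteq\mathbb{M}\}$ and $\mathrm{FRsups}(\mathbb{M},\Lambda)=\{X\in\mathrm{FR}(\Lambda)\mid\mathbb{M}\subseteq X$ and no $Y\in\mathrm{FR}(\Lambda)$ has $\mathbb{M}\subseteq Y\subsetneq X\}$. $\Lambda$ is eviction-compatible if $\mathrm{FRsubs}(\mathrm{Mod}(B)\setminus\mathbb{M},\Lambda)\neq\emptyset$ for all finite $B\subseteq\mathcal{L}$ and all $\mathbb{M}\subseteq\mathfrak{M}$; it is reception-compatible if $\mathrm{FRsups}(\mathrm{Mod}(B)\cup\mathbb{M},\Lambda)\neq\emptyset$ for all finite $B\subseteq\mathcal{L}$ and all $\mathbb{M}\subseteq\mathfrak{M}$. In a poset $(P,\prec)$ (strict order), $x$ is an immediate predecessor of $y$ if $x\prec y$ and there is no $x'\in P$ with $x\prec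 x'\prec y$; $z$ is an immediate successor of $y$ if $y\prec z$ and there is no $z'\in P$ with $y\prec z'\prec z$. -}

module Defs where

open import Level using (Level; 0ℓ) renaming (suc to lsuc)
open import Data.Product using (Σ; Σ-syntax; _×_; _,_)
open import Data.Sum using (_⊎_)
open import Data.List using (List)
open import Data.List.Membership.Propositional using (_∈_)
open import Relation.Nullary using (¬_)

-- A satisfaction system Λ = (ℒ, 𝔐, ⊨).  Sets of formulae are predicates on
-- Form; ⊨ relates a model to an (arbitrary) set of formulae.
record SatSystem : Set₂ where
  field
    Form  : Set
    Model : Set
    _⊨_   : Model → (Form → Set) → Set

module _ (Λ : SatSystem) where
  open SatSystem Λ

  MSet : Set₁
  MSet = Model → Set

  _⊆_ : MSet → MSet → Set
  X ⊆ Y = ∀ m → X m → Y m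

  _≐_ : MSet → MSet → Set
  X ≐ Y = X ⊆ Y × Y ⊆ X

  _⊊_ : MSet → MSet → Set
  X ⊊ Y = X ⊆ Y × ¬ (Y ⊆ X)

  _∖_ : MSet → MSet → MSet
  (X ∖ Y) m = X m × ¬ Y m

  _∪_ : MSet → MSet → MSet
  (X ∪ Y) m = X m ⊎ Y m

  -- B ⊆ ℒ is finite: it is (extensionally) the set of members of a list
  Finite : (Form → Set) → Set
  Finite B = Σ[ l ∈ List Form ] (∀ φ → (B φ → φ ∈ l) × (φ ∈ l → B φ))

  Mod : (Form → Set) → MSet
  Mod B m = m ⊨ B

  FR : MSet → Set₁
  FR X = Σ[ B ∈ (Form → Set) ] (Finite B × (X ≐ Mod B))

  FRsubs : MSet → MSet → Set₁
  FRsubs 𝕄 X = FR X × X ⊆ 𝕄 × ¬ (Σ[ Y ∈ MSet ] (FR Y × X ⊊ Y × Y ⊆ 𝕄))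

  FRsups : MSet → MSet → Set₁
  FRsups 𝕄 X = FR X × 𝕄 ⊆ X × ¬ (Σ[ Y ∈ MSet ] (FR Y × 𝕄 ⊆ Y × Y ⊊ X))

  EvictionCompatible : Set₁
  EvictionCompatible =
    ∀ (B : Form → Set) → Finite B → ∀ (𝕄 : MSet) →
    Σ[ X ∈ MSet ] FRsubs (Mod B ∖ 𝕄) X

  ReceptionCompatible : Set₁
  ReceptionCompatible =
    ∀ (B : Form → Set) → Finite B → ∀ (𝕄 : MSet) →
    Σ[ X ∈ MSet ] FRsups (Mod B ∪ 𝕄) X

  -- the carrier of the poset (FR(Λ) ∪ {𝕄}, ⊊)
  FR∪ : MSet → MSet → Set₁
  FR∪ 𝕄 X = FR X ⊎ (X ≐ 𝕄)

  ImmediatePredecessor : (MSet → Set₁) → MSet → MSet → Set₁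
  ImmediatePredecessor P x y =
    P x × P y × x ⊊ y × ¬ (Σ[ x' ∈ MSet ] (P x' × x ⊊ x' × x' ⊊ y))

  ImmediateSuccessor : (MSet → Set₁) → MSet → MSet → Set₁
  ImmediateSuccessor P z y =
    P y × P z × y ⊊ z × ¬ (Σ[ z' ∈ MSet ] (P z' × y ⊊ z' × z' ⊊ z))

  EvictionCondition : MSet → Set₁
  EvictionCondition 𝕄 =
    FR 𝕄
    ⊎ (Σ[ X ∈ MSet ] ImmediatePredecessor (FR∪ 𝕄) X 𝕄)
    ⊎ ¬ (Σ[ 𝕄' ∈ MSet ] (FR 𝕄' × 𝕄 ⊆ 𝕄'))

  ReceptionCondition : MSet → Set₁
  ReceptionCondition 𝕄 =
    FR 𝕄
    ⊎ (Σ[ Z ∈ MSet ] ImmediateSuccessor (FR∪ 𝕄) Z 𝕄)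
    ⊎ ¬ (Σ[ 𝕄' ∈ MSet ] (FR 𝕄' × 𝕄' ⊆ 𝕄))

{-# OPTIONS --safe #-}

-- Both compatibility notions say that certain sets have a maximal finitely
-- representable subset (FRsubs) or a minimal one above them (FRsups).  Any set
-- 𝕄 ⊆ Mod B is of the form Mod B ∖ (Mod B ∖ 𝕄), and any set ⊇ Mod B is of the
-- form Mod B ∪ 𝕄, so eviction-compatibility says that FRsubs(𝕄) ≠ ∅ whenever
-- 𝕄 lies under some FR set, and dually for reception.  Locally, a maximal FR
-- subset X of 𝕄 is either 𝕄 itself (𝕄 ∈ FR) or, when X ⊊ 𝕄, an immediate
-- predecessor of 𝕄 in FR(Λ) ∪ {𝕄}; conversely an immediate predecessor of an
-- 𝕄 ∉ FR is such a maximal subset.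
module Submission where

open import Defs
  using (SatSystem; EvictionCompatible; ReceptionCompatible; EvictionCondition; ReceptionCondition)
import Defs as D
open import Level using (0ℓ; lift; lower) renaming (suc to lsuc)
open import Data.Product using (Σ-syntax; _×_; _,_; proj₁)
open import Data.Sum using (_⊎_; inj₁; inj₂; [_,_]; assocˡ; assocʳ)
open import Function using (id)
open import Function.Bundles using (_⇔_; mk⇔; Equivalence)
import Function.Properties.Equivalence as ⇔
open import Function.Related.TypeIsomorphisms using (→-cong-⇔)
open import Axiom.ExcludedMiddle using (ExcludedMiddle)
open import Relation.Nullary using (¬_; Dec; yes; no; contradiction)
open import Relation.Nullary.Decidable using (map′; decidable-stable)

Π-cong-⇔ : ∀ {a p q} {A : Set a} {P : A → Set p} {Q : A → Set q} →
           (∀ x → P x ⇔ Q x) → (∀ x → P x) ⇔ (∀ x → Q x)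
Π-cong-⇔ P⇔Q = mk⇔ (λ p x → Equivalence.to (P⇔Q x) (p x))
                   (λ q x → Equivalence.from (P⇔Q x) (q x))

⊎-¬⇔→ : ∀ {a ℓ} → ExcludedMiddle ℓ → {A : Set a} {S : Set ℓ} → (A ⊎ ¬ S) ⇔ (S → A)
⊎-¬⇔→ em {S = S} = mk⇔ (λ { (inj₁ a) _ → a ; (inj₂ ¬s) s → contradiction s ¬s }) from
  where
  from : ∀ {A} → (S → A) → A ⊎ ¬ S
  from s→a with em {S}
  ... | yes s = inj₁ (s→a s)
  ... | no ¬s = inj₂ ¬s

module _ (Λ : SatSystem) where
  open SatSystem Λ

  MSet : Set₁
  MSet = D.MSet Λ

  infix 4 _⊆_ _≐_ _⊊_
  infixl 6 _∖_ _∪_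

  _⊆_ _≐_ _⊊_ : MSet → MSet → Set
  _⊆_ = D._⊆_ Λ
  _≐_ = D._≐_ Λ
  _⊊_ = D._⊊_ Λ

  _∖_ _∪_ : MSet → MSet → MSet
  _∖_ = D._∖_ Λ
  _∪_ = D._∪_ Λ

  Mod : (Form → Set) → MSet
  Mod = D.Mod Λ

  FR : MSet → Set₁
  FR = D.FR Λ

  FRsubs FRsups FR∪ : MSet → MSet → Set₁
  FRsubs = D.FRsubs Λ
  FRsups = D.FRsups Λ
  FR∪ = D.FR∪ Λ

  HasFRSuperset HasFRSubset : MSet → Set₁
  HasFRSuperset 𝕄 = Σ[ 𝕄' ∈ MSet ] (FR 𝕄' × 𝕄 ⊆ 𝕄')
  HasFRSubset 𝕄 = Σ[ 𝕄' ∈ MSet ] (FR 𝕄' × 𝕄' ⊆ 𝕄)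

  ⊆-refl : ∀ {X} → X ⊆ X
  ⊆-refl _ x = x

  ⊆-trans : ∀ {X Y Z} → X ⊆ Y → Y ⊆ Z → X ⊆ Z
  ⊆-trans X⊆Y Y⊆Z m x = Y⊆Z m (X⊆Y m x)

  FR-resp-≐ : ∀ {X Y} → X ≐ Y → FR X → FR Y
  FR-resp-≐ (X⊆Y , Y⊆X) (B , fin , X⊆Mod , Mod⊆X) = B , fin , ⊆-trans Y⊆X X⊆Mod , ⊆-trans Mod⊆X X⊆Y

  Mod-FR : ∀ {B} → D.Finite Λ B → FR (Mod B)
  Mod-FR {B} fin = B , fin , ⊆-refl , ⊆-refl

  ∪-absorbˡ : ∀ {X Y} → X ⊆ Y → X ∪ Y ≐ Y
  ∪-absorbˡ X⊆Y = (λ m → [ X⊆Y m , id ]) , (λ _ → inj₂)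

  FRsubs-resp-≐ : ∀ {𝕄 𝕄' X} → 𝕄 ≐ 𝕄' → FRsubs 𝕄 X → FRsubs 𝕄' X
  FRsubs-resp-≐ (𝕄⊆𝕄' , 𝕄'⊆𝕄) (frX , X⊆𝕄 , maximal) =
    frX , ⊆-trans X⊆𝕄 𝕄⊆𝕄' ,
    λ (Y , frY , X⊊Y , Y⊆𝕄') → maximal (Y , frY , X⊊Y , ⊆-trans Y⊆𝕄' 𝕄'⊆𝕄)

  FRsups-resp-≐ : ∀ {𝕄 𝕄' X} → 𝕄 ≐ 𝕄' → FRsups 𝕄 X → FRsups 𝕄' X
  FRsups-resp-≐ (𝕄⊆𝕄' , 𝕄'⊆𝕄) (frX , 𝕄⊆X , minimal) =
    frX , ⊆-trans 𝕄'⊆𝕄 𝕄⊆X ,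
    λ (Y , frY , 𝕄'⊆Y , Y⊊X) → minimal (Y , frY , ⊆-trans 𝕄⊆𝕄' 𝕄'⊆Y , Y⊊X)

  FR⇒FRsubs-self : ∀ {𝕄} → FR 𝕄 → FRsubs 𝕄 𝕄
  FR⇒FRsubs-self fr = fr , ⊆-refl , λ (_ , _ , (_ , Y⊈𝕄) , Y⊆𝕄) → Y⊈𝕄 Y⊆𝕄

  FR⇒FRsups-self : ∀ {𝕄} → FR 𝕄 → FRsups 𝕄 𝕄
  FR⇒FRsups-self fr = fr , ⊆-refl , λ (_ , _ , 𝕄⊆Y , (_ , 𝕄⊈Y)) → 𝕄⊈Y 𝕄⊆Y

  FRsubs⇒immediatePredecessor : ∀ {𝕄 X} → FRsubs 𝕄 X → ¬ (𝕄 ⊆ X) →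
                                D.ImmediatePredecessor Λ (FR∪ 𝕄) X 𝕄
  FRsubs⇒immediatePredecessor (frX , X⊆𝕄 , maximal) 𝕄⊈X =
    inj₁ frX , inj₂ (⊆-refl , ⊆-refl) , (X⊆𝕄 , 𝕄⊈X) , λ where
      (Y , inj₁ frY , X⊊Y , (Y⊆𝕄 , _)) → maximal (Y , frY , X⊊Y , Y⊆𝕄)
      (Y , inj₂ (_ , 𝕄⊆Y) , _ , (_ , 𝕄⊈Y)) → 𝕄⊈Y 𝕄⊆Y

  FRsups⇒immediateSuccessor : ∀ {𝕄 X} → FRsups 𝕄 X → ¬ (X ⊆ 𝕄) →
                              D.ImmediateSuccessor Λ (FR∪ 𝕄) X 𝕄
  FRsups⇒immediateSuccessor (frX , 𝕄⊆X , minimal) X⊈𝕄 =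
    inj₂ (⊆-refl , ⊆-refl) , inj₁ frX , (𝕄⊆X , X⊈𝕄) , λ where
      (Y , inj₁ frY , (𝕄⊆Y , _) , Y⊊X) → minimal (Y , frY , 𝕄⊆Y , Y⊊X)
      (Y , inj₂ (Y⊆𝕄 , _) , (_ , Y⊈𝕄) , _) → Y⊈𝕄 Y⊆𝕄

  immediatePredecessor⇒FRsubs : ∀ {𝕄 X} → D.ImmediatePredecessor Λ (FR∪ 𝕄) X 𝕄 → ¬ FR 𝕄 →
                                FRsubs 𝕄 X
  immediatePredecessor⇒FRsubs (inj₂ (_ , 𝕄⊆X) , _ , (_ , 𝕄⊈X) , _) _ = contradiction 𝕄⊆X 𝕄⊈X
  immediatePredecessor⇒FRsubs (inj₁ frX , _ , (X⊆𝕄 , _) , immediate) 𝕄∉FR =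
    frX , X⊆𝕄 , λ (Y , frY , X⊊Y , Y⊆𝕄) →
      immediate (Y , inj₁ frY , X⊊Y , (Y⊆𝕄 , λ 𝕄⊆Y → 𝕄∉FR (FR-resp-≐ (Y⊆𝕄 , 𝕄⊆Y) frY)))

  immediateSuccessor⇒FRsups : ∀ {𝕄 X} → D.ImmediateSuccessor Λ (FR∪ 𝕄) X 𝕄 → ¬ FR 𝕄 →
                              FRsups 𝕄 X
  immediateSuccessor⇒FRsups (_ , inj₂ (X⊆𝕄 , _) , (_ , X⊈𝕄) , _) _ = contradiction X⊆𝕄 X⊈𝕄
  immediateSuccessor⇒FRsups (_ , inj₁ frX , (𝕄⊆X , _) , immediate) 𝕄∉FR =
    frX , 𝕄⊆X , λ (Y , frY , 𝕄⊆Y , Y⊊X) →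
      immediate (Y , inj₁ frY , (𝕄⊆Y , λ Y⊆𝕄 → 𝕄∉FR (FR-resp-≐ (Y⊆𝕄 , 𝕄⊆Y) frY)) , Y⊊X)

  module Classical (em : ExcludedMiddle (lsuc 0ℓ)) where

    decide : (P : Set) → Dec P
    decide P = map′ lower lift em

    ∖-∖-≐ : ∀ {𝕄 N} → 𝕄 ⊆ N → N ∖ (N ∖ 𝕄) ≐ 𝕄
    ∖-∖-≐ {𝕄} 𝕄⊆N = (λ m (n , ¬n∖𝕄) → decidable-stable (decide (𝕄 m)) (λ m∉𝕄 → ¬n∖𝕄 (n , m∉𝕄)))
                   , (λ m m∈𝕄 → 𝕄⊆N m m∈𝕄 , λ (_ , m∉𝕄) → m∉𝕄 m∈𝕄)

    FRsubs-nonempty⇔ : ∀ {𝕄} → (Σ[ X ∈ MSet ] FRsubs 𝕄 X) ⇔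
                       (FR 𝕄 ⊎ Σ[ X ∈ MSet ] D.ImmediatePredecessor Λ (FR∪ 𝕄) X 𝕄)
    FRsubs-nonempty⇔ {𝕄} = mk⇔ to from
      where
      to : Σ[ X ∈ MSet ] FRsubs 𝕄 X → FR 𝕄 ⊎ Σ[ X ∈ MSet ] D.ImmediatePredecessor Λ (FR∪ 𝕄) X 𝕄
      to (X , subs@(frX , X⊆𝕄 , _)) with decide (𝕄 ⊆ X)
      ... | yes 𝕄⊆X = inj₁ (FR-resp-≐ (X⊆𝕄 , 𝕄⊆X) frX)
      ... | no 𝕄⊈X = inj₂ (X , FRsubs⇒immediatePredecessor subs 𝕄⊈X)

      from : FR 𝕄 ⊎ Σ[ X ∈ MSet ] D.ImmediatePredecessor Λ (FR∪ 𝕄) X 𝕄 → Σ[ X ∈ MSet ] FRsubs 𝕄 X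
      from (inj₁ fr) = 𝕄 , FR⇒FRsubs-self fr
      from (inj₂ (X , pred)) with em {FR 𝕄}
      ... | yes fr = 𝕄 , FR⇒FRsubs-self fr
      ... | no 𝕄∉FR = X , immediatePredecessor⇒FRsubs pred 𝕄∉FR

    FRsups-nonempty⇔ : ∀ {𝕄} → (Σ[ X ∈ MSet ] FRsups 𝕄 X) ⇔
                       (FR 𝕄 ⊎ Σ[ X ∈ MSet ] D.ImmediateSuccessor Λ (FR∪ 𝕄) X 𝕄)
    FRsups-nonempty⇔ {𝕄} = mk⇔ to from
      where
      to : Σ[ X ∈ MSet ] FRsups 𝕄 X → FR 𝕄 ⊎ Σ[ X ∈ MSet ] D.ImmediateSuccessor Λ (FR∪ 𝕄) X 𝕄
      to (X , sups@(frX , 𝕄⊆X , _)) with decide (X ⊆ 𝕄)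
      ... | yes X⊆𝕄 = inj₁ (FR-resp-≐ (X⊆𝕄 , 𝕄⊆X) frX)
      ... | no X⊈𝕄 = inj₂ (X , FRsups⇒immediateSuccessor sups X⊈𝕄)

      from : FR 𝕄 ⊎ Σ[ X ∈ MSet ] D.ImmediateSuccessor Λ (FR∪ 𝕄) X 𝕄 → Σ[ X ∈ MSet ] FRsups 𝕄 X
      from (inj₁ fr) = 𝕄 , FR⇒FRsups-self fr
      from (inj₂ (X , succ)) with em {FR 𝕄}
      ... | yes fr = 𝕄 , FR⇒FRsups-self fr
      ... | no 𝕄∉FR = X , immediateSuccessor⇒FRsups succ 𝕄∉FR

    evictionCompatible⇔ : EvictionCompatible Λ ⇔
                          (∀ 𝕄 → HasFRSuperset 𝕄 → Σ[ X ∈ MSet ] FRsubs 𝕄 X)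
    evictionCompatible⇔ = mk⇔ to from
      where
      to : EvictionCompatible Λ → ∀ 𝕄 → HasFRSuperset 𝕄 → Σ[ X ∈ MSet ] FRsubs 𝕄 X
      to compatible 𝕄 (_ , (B , fin , 𝕄'⊆Mod , _) , 𝕄⊆𝕄') =
        let X , subs = compatible B fin (Mod B ∖ 𝕄)
        in X , FRsubs-resp-≐ (∖-∖-≐ (⊆-trans 𝕄⊆𝕄' 𝕄'⊆Mod)) subs

      from : (∀ 𝕄 → HasFRSuperset 𝕄 → Σ[ X ∈ MSet ] FRsubs 𝕄 X) → EvictionCompatible Λ
      from h B fin 𝕄 = h (Mod B ∖ 𝕄) (Mod B , Mod-FR fin , λ _ → proj₁)

    receptionCompatible⇔ : ReceptionCompatible Λ ⇔
                           (∀ 𝕄 → HasFRSubset 𝕄 → Σ[ X ∈ MSet ] FRsups 𝕄 X)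
    receptionCompatible⇔ = mk⇔ to from
      where
      to : ReceptionCompatible Λ → ∀ 𝕄 → HasFRSubset 𝕄 → Σ[ X ∈ MSet ] FRsups 𝕄 X
      to compatible 𝕄 (_ , (B , fin , _ , Mod⊆𝕄') , 𝕄'⊆𝕄) =
        let X , sups = compatible B fin 𝕄
        in X , FRsups-resp-≐ (∪-absorbˡ (⊆-trans Mod⊆𝕄' 𝕄'⊆𝕄)) sups

      from : (∀ 𝕄 → HasFRSubset 𝕄 → Σ[ X ∈ MSet ] FRsups 𝕄 X) → ReceptionCompatible Λ
      from h B fin 𝕄 = h (Mod B ∪ 𝕄) (Mod B , Mod-FR fin , λ _ → inj₁)

    evictionCondition⇔ : ∀ 𝕄 → EvictionCondition Λ 𝕄 ⇔
                         (HasFRSuperset 𝕄 → Σ[ X ∈ MSet ] FRsubs 𝕄 X)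
    evictionCondition⇔ 𝕄 =
      ⇔.trans (mk⇔ assocˡ assocʳ)
        (⇔.trans (⊎-¬⇔→ em) (→-cong-⇔ ⇔.refl (⇔.sym FRsubs-nonempty⇔)))

    receptionCondition⇔ : ∀ 𝕄 → ReceptionCondition Λ 𝕄 ⇔
                          (HasFRSubset 𝕄 → Σ[ X ∈ MSet ] FRsups 𝕄 X)
    receptionCondition⇔ 𝕄 =
      ⇔.trans (mk⇔ assocˡ assocʳ)
        (⇔.trans (⊎-¬⇔→ em) (→-cong-⇔ ⇔.refl (⇔.sym FRsups-nonempty⇔)))

theorem3 : (Λ : SatSystem) → ExcludedMiddle (lsuc 0ℓ) →
    (EvictionCompatible Λ ⇔ (∀ 𝕄 → EvictionCondition Λ 𝕄))
    × (ReceptionCompatible Λ ⇔ (∀ 𝕄 → ReceptionCondition Λ 𝕄))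
theorem3 Λ em =
  ⇔.trans evictionCompatible⇔ (Π-cong-⇔ λ 𝕄 → ⇔.sym (evictionCondition⇔ 𝕄)) ,
  ⇔.trans receptionCompatible⇔ (Π-cong-⇔ λ 𝕄 → ⇔.sym (receptionCondition⇔ 𝕄))
  where open Classical Λ em
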